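{- Let $n\ge2$, $k\ge1$, and let $\pi\in\mathcal{P}_n^{(k)}$ with $\rho(\pi)=n-1$. For any maximal chain $\hat0=x_0\lessdot x_1\lessdot\dots\lessdot x_{n-1}=\pi$ in $\mathcal{P}_n^{(k)}$, with edge labels $(\alpha_i,\beta_i)_{l_i}$ for $x_{i-1}\lessdot x_i$, each integer in $\{2,3,\dots,n\}$ occurs exactly once among $\beta_1,\dots,\beta_{n-1}$.
   Context: Write $[n]=\{1,\dots,n\}$. A weighted partition of $[n]$ with $k$ layers is a $k$-tuple $\pi=(\pi^{(1)},\dots,\pi^{(k)})$ of set partitions of $[n]$ such that $\pi^{(l+1)}$ refines $\pi^{(l)}$ for $1\le l<k$. $\mathcal{P}_n^{(k)}$ is the set of these; rank $\rho(\pi)=n-(\text{number of blocks of }\pi^{(1)})$. Labeled covers: for $\pi\in\mathcal{P}_n^{(k)}$, $1\le\alpha<\beta\le n$, $l\in[k]$, the label $(\alpha,\beta)_l$ is admissible at $\pi$ if $\alpha,\beta$ lie in different blocks $A\ni\alpha$, $B\ni\beta$ of $\pi^{(1)}$, $\beta=\min B$, and $\alpha$ is the smallest element of its block in $\pi^{(l)}$; then $\pi'$ is obtained by replacing, for each $m=1,\dots,l$, the two blocks of $\pi^{(m)}$ containing $\alpha$ and $\beta$ by their union, with $\pi'^{(m)}=\pi^{(m)}$ for $m>l$, and we declare $\pi\lessdot\pi'$ with edge label $(\alpha,\beta)_l$. The order is the reflexive-transitive closure of these covers; $\hat0$ is the all-singletons element. -}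

module Defs where

open import Data.Nat using (ℕ; zero; suc; _∸_; _≤ᵇ_)
open import Data.Fin using (Fin; toℕ; _<_; _≟_)
open import Data.Vec using (Vec; lookup; tabulate; map)
open import Data.List using (List; []; _∷_; length; filterᵇ)
open import Data.Bool using (Bool; true; false; if_then_else_; _∨_)
open import Data.Product using (_×_; Σ)
open import Relation.Binary.PropositionalEquality using (_≡_; _≢_)
open import Relation.Nullary.Decidable using (⌊_⌋)

-- Elements of [n] = {1,…,n} are represented by Fin n (element i+1 ↦ index i).
-- A set partition of [n] is represented canonically by the vector sending each
-- element to the minimum of its block.
RawPartition : ℕ → Set
RawPartition n = Vec (Fin n) n

IsSetPartition : ∀ {n} → RawPartition n → Set
IsSetPartition {n} p = (x : Fin n) →
  (toℕ (lookup p x) Data.Nat.≤ toℕ x) × (lookup p (lookup p x) ≡ lookup p x)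

SameBlock : ∀ {n} → RawPartition n → Fin n → Fin n → Set
SameBlock p x y = lookup p x ≡ lookup p y

Refines : ∀ {n} → RawPartition n → RawPartition n → Set
Refines {n} q p = (x y : Fin n) → SameBlock q x y → SameBlock p x y

RawWeighted : ℕ → ℕ → Set
RawWeighted n k = Vec (RawPartition n) k

IsWeightedPartition : ∀ {n k} → RawWeighted n k → Set
IsWeightedPartition {n} {k} π =
  ((l : Fin k) → IsSetPartition (lookup π l)) ×
  ((l l' : Fin k) → toℕ l' ≡ suc (toℕ l) → Refines (lookup π l') (lookup π l))

-- number of blocks of a set partition (= number of block minima)
numBlocks : ∀ {n} → RawPartition n → ℕ
numBlocks {n} p = length (filterᵇ (λ x → ⌊ lookup p x ≟ x ⌋) (Data.List.allFin n))

-- rank ρ(π) = n − #blocks of π^(1)  (layers are indexed by Fin (suc k))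
rank : ∀ {n k} → RawWeighted n (suc k) → ℕ
rank {n} π = n ∸ numBlocks (lookup π Data.Fin.zero)

bottom : ∀ n k → RawWeighted n k
bottom n k = tabulate (λ _ → tabulate (λ x → x))

record Label (n k : ℕ) : Set where
  constructor lab
  field
    α : Fin n
    β : Fin n
    l : Fin k
open Label public

minFin : ∀ {n} → Fin n → Fin n → Fin n
minFin a b = if toℕ a ≤ᵇ toℕ b then a else b

mergeBlocks : ∀ {n} → RawPartition n → Fin n → Fin n → RawPartition n
mergeBlocks p a b =
  let a' = lookup p a ; b' = lookup p b ; m = minFin a' b' in
  map (λ y → if ⌊ y ≟ a' ⌋ ∨ ⌊ y ≟ b' ⌋ then m else y) p

Admissible : ∀ {n k} → RawWeighted n (suc k) → Label n (suc k) → Set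
Admissible π (lab a b l) =
  (a < b) ×
  (lookup (lookup π Data.Fin.zero) a ≢ lookup (lookup π Data.Fin.zero) b) ×
  (lookup (lookup π Data.Fin.zero) b ≡ b) ×
  (lookup (lookup π l) a ≡ a)

applyLabel : ∀ {n k} → RawWeighted n k → Label n k → RawWeighted n k
applyLabel π (lab a b l) =
  tabulate (λ m → if toℕ m ≤ᵇ toℕ l then mergeBlocks (lookup π m) a b else lookup π m)

Cover : ∀ {n k} → RawWeighted n (suc k) → Label n (suc k) → RawWeighted n (suc k) → Set
Cover π L π' = Admissible π L × (π' ≡ applyLabel π L)

data CoverChain {n k : ℕ} : RawWeighted n (suc k) → RawWeighted n (suc k) →
                            List (Label n (suc k)) → Set where
  done : ∀ {x} → CoverChain x x []
  step : ∀ {x y z L Ls} → Cover x L y → CoverChain y z Ls → CoverChain x z (L ∷ Ls)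

countβ : ∀ {n k} → Fin n → List (Label n k) → ℕ
countβ b Ls = length (filterᵇ (λ L → ⌊ β L ≟ b ⌋) Ls)

{-# OPTIONS --safe #-}
-- Read the first layer of a weighted partition as the map sending each element to the
-- minimum of its block; it lies below the identity, and merging two blocks only lowers
-- entries. A cover with label (α,β)_l needs β to be a block minimum and afterwards sends
-- β to at most α < β, so β is never a block minimum again: the β's along a chain are
-- distinct. They also avoid the element 1 (β > α), so n − 1 of them must exhaust {2,…,n}.
module Submission where

open import Defs
open import Data.Nat using (ℕ; suc; _≤_; _∸_)
open import Data.Fin using (Fin; toℕ)
open import Data.List using (List; length)
open import Relation.Binary.PropositionalEquality using (_≡_; _≢_)

open import Data.Bool using (true; false; if_then_else_; _∨_)
open import Data.Empty using (⊥-elim)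
open import Data.Product using (_,_)
open import Data.Fin as Fin using (zero; suc; _≟_)
open import Data.Fin.Properties using (toℕ-injective)
open import Data.List using ([]; _∷_; map; tabulate; removeAt)
open import Data.List.Properties using (length-map; length-tabulate; length-removeAt′)
open import Data.List.Membership.Propositional using (_∈_; _∉_)
open import Data.List.Membership.Propositional.Properties using (∈-tabulate⁺)
open import Data.List.Relation.Binary.Subset.Propositional using (_⊆_)
open import Data.List.Relation.Unary.All as All using (All; []; _∷_)
open import Data.List.Relation.Unary.All.Properties using (All¬⇒¬Any; ¬Any⇒All¬; map⁺)
open import Data.List.Relation.Unary.Any using (here; there; index)
open import Data.List.Relation.Unary.Unique.Propositional using (Unique; []; _∷_)
open import Data.Nat using (_<_; _≤ᵇ_; z≤n; s≤s)
open import Data.Nat.Properties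
  using (≤-refl; ≤-trans; ≤-reflexive; ≤-antisym; <⇒≢; <-irrefl;
         ≰⇒>; <⇒≤; n≮0; ≤ᵇ-reflects-≤; module ≤-Reasoning)
open import Data.Vec using (lookup)
open import Data.Vec.Properties using (lookup-map; lookup∘tabulate)
open import Function using (_∘_; id)
open import Relation.Binary.PropositionalEquality using (refl; sym; trans; cong)
open import Relation.Nullary using (yes; no)
open import Relation.Nullary.Decidable using (⌊_⌋)
open import Relation.Nullary.Reflects using (ofʸ; ofⁿ)

private
  variable
    A : Set
    n k : ℕ

∈-removeAt : {x y : A} {ys : List A} (x∈ys : x ∈ ys) → y ∈ ys → x ≢ y →
             y ∈ removeAt ys (index x∈ys)
∈-removeAt (here refl)  (here refl)  x≢y = ⊥-elim (x≢y refl)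
∈-removeAt (here refl)  (there y∈ys) _   = y∈ys
∈-removeAt (there _)    (here refl)  _   = here refl
∈-removeAt (there x∈ys) (there y∈ys) x≢y = there (∈-removeAt x∈ys y∈ys x≢y)

Unique-⊆⇒length≤ : {xs ys : List A} → Unique xs → xs ⊆ ys → length xs ≤ length ys
Unique-⊆⇒length≤ [] _ = z≤n
Unique-⊆⇒length≤ {xs = x ∷ xs} {ys} (x∉xs ∷ u) xs⊆ys = begin
  suc (length xs)                         ≤⟨ s≤s (Unique-⊆⇒length≤ u xs⊆ys-x) ⟩
  suc (length (removeAt ys (index x∈ys))) ≡⟨ sym (length-removeAt′ ys (index x∈ys)) ⟩
  length ys                               ∎
  where
  open ≤-Reasoning
  x∈ys : x ∈ ys
  x∈ys = xs⊆ys (here refl)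
  xs⊆ys-x : xs ⊆ removeAt ys (index x∈ys)
  xs⊆ys-x y∈xs = ∈-removeAt x∈ys (xs⊆ys (there y∈xs)) (All.lookup x∉xs y∈xs)

Unique-⊆-∉⇒length< : {xs ys : List A} {y : A} →
                     Unique xs → xs ⊆ ys → y ∈ ys → y ∉ xs → length xs < length ys
Unique-⊆-∉⇒length< u xs⊆ys y∈ys y∉xs =
  Unique-⊆⇒length≤ (¬Any⇒All¬ _ y∉xs ∷ u) λ { (here refl) → y∈ys ; (there y∈xs) → xs⊆ys y∈xs }

≢zero⇒∈-tabulate-suc : {c : Fin (suc n)} → c ≢ zero → c ∈ tabulate suc
≢zero⇒∈-tabulate-suc {c = zero}  c≢0 = ⊥-elim (c≢0 refl)
≢zero⇒∈-tabulate-suc {c = suc c} _   = ∈-tabulate⁺ c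

Unique-≢zero⇒∈ : {xs : List (Fin (suc n))} → Unique xs → All (_≢ zero) xs → length xs ≡ n →
                 {c : Fin (suc n)} → c ≢ zero → c ∈ xs
Unique-≢zero⇒∈ {n} {xs} u xs≢0 length≡n {c} c≢0 with c ∈? xs
  where open import Data.List.Membership.DecPropositional (_≟_ {suc n}) using (_∈?_)
... | yes c∈xs = c∈xs
... | no c∉xs  = ⊥-elim (<-irrefl length-xs
                   (Unique-⊆-∉⇒length< u (≢zero⇒∈-tabulate-suc ∘ All.lookup xs≢0)
                                         (≢zero⇒∈-tabulate-suc c≢0) c∉xs))
  where
  length-xs : length xs ≡ length (tabulate (Fin.suc {n}))
  length-xs = trans length≡n (sym (length-tabulate Fin.suc))

Deflationary : RawPartition n → Set
Deflationary {n} p = (x : Fin n) → toℕ (lookup p x) ≤ toℕ x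

minFin-≤ˡ : (a b : Fin n) → toℕ (minFin a b) ≤ toℕ a
minFin-≤ˡ a b with toℕ a ≤ᵇ toℕ b | ≤ᵇ-reflects-≤ (toℕ a) (toℕ b)
... | true  | ofʸ _   = ≤-refl
... | false | ofⁿ a≰b = <⇒≤ (≰⇒> a≰b)

minFin-≤ʳ : (a b : Fin n) → toℕ (minFin a b) ≤ toℕ b
minFin-≤ʳ a b with toℕ a ≤ᵇ toℕ b | ≤ᵇ-reflects-≤ (toℕ a) (toℕ b)
... | true  | ofʸ a≤b = a≤b
... | false | ofⁿ _   = ≤-refl

mergeEntry : Fin n → Fin n → Fin n → Fin n
mergeEntry a′ b′ y = if ⌊ y ≟ a′ ⌋ ∨ ⌊ y ≟ b′ ⌋ then minFin a′ b′ else y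

lookup-mergeBlocks : (p : RawPartition n) (a b y : Fin n) →
                     lookup (mergeBlocks p a b) y ≡ mergeEntry (lookup p a) (lookup p b) (lookup p y)
lookup-mergeBlocks p a b y = lookup-map y (mergeEntry (lookup p a) (lookup p b)) p

mergeEntry-≤ : (a′ b′ y : Fin n) → toℕ (mergeEntry a′ b′ y) ≤ toℕ y
mergeEntry-≤ a′ b′ y with y ≟ a′ | y ≟ b′
... | yes refl | _        = minFin-≤ˡ y b′
... | no _     | yes refl = minFin-≤ʳ a′ y
... | no _     | no _     = ≤-refl

mergeEntry-second : (a′ b′ : Fin n) → mergeEntry a′ b′ b′ ≡ minFin a′ b′
mergeEntry-second a′ b′ with b′ ≟ a′ | b′ ≟ b′
... | yes _ | _      = refl
... | no _  | yes _  = refl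
... | no _  | no b≢b = ⊥-elim (b≢b refl)

module MergeBlocks (p : RawPartition n) (a b : Fin n) where

  lookup-mergeBlocks-≤ : (y : Fin n) → toℕ (lookup (mergeBlocks p a b) y) ≤ toℕ (lookup p y)
  lookup-mergeBlocks-≤ y = ≤-trans (≤-reflexive (cong toℕ (lookup-mergeBlocks p a b y)))
                                   (mergeEntry-≤ (lookup p a) (lookup p b) (lookup p y))

  mergeBlocks-deflationary : Deflationary p → Deflationary (mergeBlocks p a b)
  mergeBlocks-deflationary defl y = ≤-trans (lookup-mergeBlocks-≤ y) (defl y)

  mergeBlocks-fixed⇒fixed : Deflationary p → {y : Fin n} →
                            lookup (mergeBlocks p a b) y ≡ y → lookup p y ≡ y
  mergeBlocks-fixed⇒fixed defl {y} fixed = toℕ-injective (≤-antisym (defl y) (begin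
    toℕ y                                ≡⟨ cong toℕ (sym fixed) ⟩
    toℕ (lookup (mergeBlocks p a b) y)   ≤⟨ lookup-mergeBlocks-≤ y ⟩
    toℕ (lookup p y)                     ∎))
    where open ≤-Reasoning

  mergeBlocks-lowers-second : Deflationary p → a Fin.< b →
                              toℕ (lookup (mergeBlocks p a b) b) < toℕ b
  mergeBlocks-lowers-second defl a<b = begin-strict
    toℕ (lookup (mergeBlocks p a b) b)   ≡⟨ cong toℕ (lookup-mergeBlocks p a b b) ⟩
    toℕ (mergeEntry (lookup p a) (lookup p b) (lookup p b))
                                         ≡⟨ cong toℕ (mergeEntry-second (lookup p a) (lookup p b)) ⟩
    toℕ (minFin (lookup p a) (lookup p b)) ≤⟨ minFin-≤ˡ (lookup p a) (lookup p b) ⟩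
    toℕ (lookup p a)                     ≤⟨ defl a ⟩
    toℕ a                                <⟨ a<b ⟩
    toℕ b                                ∎
    where open ≤-Reasoning

firstLayer : RawWeighted n (suc k) → RawPartition n
firstLayer π = lookup π zero

bottom-deflationary : Deflationary (firstLayer (bottom n (suc k)))
bottom-deflationary x = ≤-reflexive (cong toℕ (lookup∘tabulate id x))

coverChain-β-fixed : {x z : RawWeighted n (suc k)} {Ls : List (Label n (suc k))} →
                     CoverChain x z Ls → Deflationary (firstLayer x) →
                     All (λ L → lookup (firstLayer x) (β L) ≡ β L) Ls
coverChain-β-fixed done _ = []
coverChain-β-fixed {x = x} (step {L = lab a b _} ((_ , _ , b-fixed , _) , refl) chain) defl =
  b-fixed ∷ All.map (mergeBlocks-fixed⇒fixed defl)
                    (coverChain-β-fixed chain (mergeBlocks-deflationary defl))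
  where open MergeBlocks (firstLayer x) a b

coverChain-β-unique : {x z : RawWeighted n (suc k)} {Ls : List (Label n (suc k))} →
                      CoverChain x z Ls → Deflationary (firstLayer x) → Unique (map β Ls)
coverChain-β-unique done _ = []
coverChain-β-unique {x = x} (step {L = lab a b _} ((a<b , _) , refl) chain) defl =
  map⁺ (All.map b-not-fixed (coverChain-β-fixed chain defl′)) ∷ coverChain-β-unique chain defl′
  where
  open MergeBlocks (firstLayer x) a b
  defl′ : Deflationary (mergeBlocks (firstLayer x) a b)
  defl′ = mergeBlocks-deflationary defl
  b-not-fixed : ∀ {y} → lookup (mergeBlocks (firstLayer x) a b) y ≡ y → b ≢ y
  b-not-fixed fixed refl = <⇒≢ (mergeBlocks-lowers-second defl a<b) (cong toℕ fixed)

coverChain-β≢zero : {x z : RawWeighted (suc n) (suc k)} {Ls : List (Label (suc n) (suc k))} →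
                    CoverChain x z Ls → All (λ L → β L ≢ zero) Ls
coverChain-β≢zero done = []
coverChain-β≢zero (step ((a<b , _) , _) chain) = (λ { refl → n≮0 a<b }) ∷ coverChain-β≢zero chain

countβ-∉ : {b : Fin n} (Ls : List (Label n k)) → b ∉ map β Ls → countβ b Ls ≡ 0
countβ-∉ [] _ = refl
countβ-∉ {b = b} (L ∷ Ls) b∉ with β L ≟ b
... | yes refl = ⊥-elim (b∉ (here refl))
... | no _     = countβ-∉ Ls (b∉ ∘ there)

countβ-unique : {b : Fin n} (Ls : List (Label n k)) →
                Unique (map β Ls) → b ∈ map β Ls → countβ b Ls ≡ 1
countβ-unique {b = b} (L ∷ Ls) (βL∉ ∷ u) b∈ with β L ≟ b | b∈
... | yes refl | _          = cong suc (countβ-∉ Ls (All¬⇒¬Any βL∉))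
... | no βL≢b  | here b≡βL  = ⊥-elim (βL≢b (sym b≡βL))
... | no _     | there b∈′  = countβ-unique Ls u b∈′

mainTheorem13 : (n k : ℕ) → 2 ≤ n →
    (π : RawWeighted n (suc k)) → IsWeightedPartition π → rank π ≡ n ∸ 1 →
    (Ls : List (Label n (suc k))) → CoverChain (bottom n (suc k)) π Ls →
    length Ls ≡ n ∸ 1 →
    (b : Fin n) → toℕ b ≢ 0 → countβ b Ls ≡ 1
mainTheorem13 (suc n) k _ π _ _ Ls chain length≡n b b≢0 =
  countβ-unique Ls βs-unique
    (Unique-≢zero⇒∈ βs-unique (map⁺ (coverChain-β≢zero chain))
                    (trans (length-map β Ls) length≡n) (b≢0 ∘ cong toℕ))
  where
  βs-unique : Unique (map β Ls)
  βs-unique = coverChain-β-unique chain (bottom-deflationary {k = k})
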